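{- Let $k\ge 2$ and let $T$ be a set of permutations, all of length at least $k$. Then every permutation of length $n>k$ has at most $C_{n-k+2}$ preimages under the map $s_T$, where $C_m=\frac{1}{m+1}\binom{2m}{m}$ is the $m$th Catalan number.
   Context: A sequence of distinct integers contains a permutation $\tau$ if some subsequence is order-isomorphic to $\tau$; otherwise it avoids $\tau$, and it avoids a set $T$ if it avoids each element of $T$. For a set $T$ of permutations (each of length at least 2), the map $s_T$ (from permutations of length $n$ to permutations of length $n$) is defined by: read the input permutation left to right with an initially empty stack and output; at each step, if there is a next input element and pushing it keeps the stack contents, read from top to bottom, $T$-avoiding, push it; otherwise pop the top of the stack and append it to the output; stop when input and stack are empty; the output is $s_T(\pi)$. -}

module Defs where

open import Data.Nat using (ℕ; zero; suc; _+_; _<_; _≤_; _/_)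
open import Data.Nat.Combinatorics using (_C_)
open import Data.List using (List; []; _∷_; length; upTo)
open import Data.List.Relation.Binary.Pointwise using (Pointwise)
open import Data.List.Relation.Binary.Sublist.Propositional using (_⊆_)
open import Data.List.Relation.Binary.Permutation.Propositional using (_↭_)
open import Data.Product using (Σ; _×_; ∃-syntax)
open import Data.Unit using (⊤)
open import Data.Empty using (⊥)
open import Relation.Nullary using (¬_)
open import Function.Bundles using (_⇔_)

IsPerm : ℕ → List ℕ → Set
IsPerm n π = π ↭ upTo n

-- Order-isomorphism of two sequences (of distinct integers): same length and,
-- for every pair of positions i < j, (a_i < a_j) ⇔ (b_i < b_j).
OrdIso : List ℕ → List ℕ → Set
OrdIso [] [] = ⊤
OrdIso (x ∷ xs) (y ∷ ys) = Pointwise (λ a b → (x < a) ⇔ (y < b)) xs ys × OrdIso xs ys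
OrdIso [] (_ ∷ _) = ⊥
OrdIso (_ ∷ _) [] = ⊥

Contains : List ℕ → List ℕ → Set
Contains σ τ = ∃[ sub ] (sub ⊆ σ × OrdIso sub τ)

Avoids : (List ℕ → Set) → List ℕ → Set
Avoids T σ = ∀ τ → T τ → ¬ Contains σ τ

-- Pushing is allowed iff there is a next input element and pushing it keeps
-- the stack (read top to bottom; head of the list = top) T-avoiding.
PushOK : (List ℕ → Set) → List ℕ → List ℕ → Set
PushOK T [] st = ⊥
PushOK T (x ∷ _) st = Avoids T (x ∷ st)

-- Run T input stack out : starting from the given remaining input and stack,
-- the algorithm (deterministically) appends exactly `out` to the output.
data Run (T : List ℕ → Set) : List ℕ → List ℕ → List ℕ → Set where
  done : Run T [] [] []
  push : ∀ {x xs st out} → Avoids T (x ∷ st) → Run T xs (x ∷ st) out → Run T (x ∷ xs) st out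
  pop  : ∀ {inp y st out} → ¬ PushOK T inp st → Run T inp st out → Run T inp (y ∷ st) (y ∷ out)

STMap : (List ℕ → Set) → List ℕ → List ℕ → Set
STMap T π σ = Run T π [] σ

catalan : ℕ → ℕ
catalan m = ((m + m) C m) / suc m

-- Record a run of the stack by its word of pushes and pops; since the output is
-- fixed, the word determines the input. Every pattern has length ≥ k, so a stack of height
-- < k avoids T: the first k − 2 moves are pushes, and while input remains no pop brings the
-- stack below k − 2. Forgetting the bottom k − 2 letters therefore leaves a lattice path with
-- n − k + 2 up-steps that never goes below 0, and there are C_{n−k+2} of those: by the
-- reflection principle, paths from height h with r up-steps number C(h+2r, r) − C(h+2r, r−1),
-- and for h = 0 absorption turns this into C(2m, m)/(m+1).
module Submission where

open import Defs
open import Data.Nat using (ℕ; zero; suc; _+_; _*_; _∸_; _≤_; _<_; z≤n; s≤s; _/_)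
open import Data.Nat.Properties
open import Data.Nat.Combinatorics
  using (_C_; nCk≡nC[n∸k]; nC1≡n; k>n⇒nCk≡0) renaming (nCk+nC[k+1]≡[n+1]C[k+1] to pascal)
open import Data.Nat.DivMod using (m*n/n≡m)
open import Data.Nat.Tactic.RingSolver using (solve-∀)
open import Data.List using (List; []; _∷_; length; replicate)
open import Data.List.Properties using (∷-injectiveʳ; length-upTo)
open import Data.List.Relation.Unary.All using (All; []; _∷_; reduce)
open import Data.List.Relation.Binary.Sublist.Propositional.Properties using (length-mono-≤)
open import Data.List.Relation.Binary.Permutation.Propositional.Properties using (↭-length)
open import Data.Product using (_×_; _,_; proj₁; proj₂)
open import Data.List.Relation.Unary.Unique.Propositional using (Unique; []; _∷_)
open import Relation.Binary.Definitions using (DecidableEquality)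
open import Relation.Nullary using (yes; no; contradiction)
open import Relation.Binary.PropositionalEquality

absorption : ∀ n k → suc k * (suc n C suc k) ≡ suc n * (n C k)
absorption zero zero = refl
absorption zero (suc k) = *-zeroʳ (suc (suc k))
absorption (suc n) zero =
  trans (+-identityʳ _) (trans (nC1≡n (suc (suc n))) (sym (*-identityʳ (suc (suc n)))))
absorption (suc n) (suc k) = begin
  suc (suc k) * (suc (suc n) C suc (suc k))    ≡⟨ cong (suc (suc k) *_) (pascal (suc n) (suc k)) ⟨
  suc (suc k) * (a + b)                        ≡⟨ regroup k a b ⟩
  a + (suc k * a + suc (suc k) * b)            ≡⟨ cong₂ (λ x y → a + (x + y)) (absorption n k) (absorption n (suc k)) ⟩
  a + (suc n * (n C k) + suc n * (n C suc k))  ≡⟨ cong (a +_) (*-distribˡ-+ (suc n) (n C k) (n C suc k)) ⟨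
  a + suc n * (n C k + n C suc k)              ≡⟨ cong (λ x → a + suc n * x) (pascal n k) ⟩
  suc (suc n) * a                              ∎
  where
  open ≡-Reasoning
  a = suc n C suc k
  b = suc n C suc (suc k)
  regroup : ∀ k a b → suc (suc k) * (a + b) ≡ a + (suc k * a + suc (suc k) * b)
  regroup = solve-∀

middle-symmetry : ∀ p → (p + suc p) C suc p ≡ (p + suc p) C p
middle-symmetry p =
  trans (nCk≡nC[n∸k] (m≤n+m (suc p) p)) (cong ((p + suc p) C_) (m+n∸n≡m p (suc p)))

central-absorption : ∀ m → suc m * ((m + m) C suc m) ≡ m * ((m + m) C m)
central-absorption zero = refl
central-absorption (suc p) = begin
  suc (suc p) * (suc n C suc (suc p))   ≡⟨ absorption n (suc p) ⟩
  suc n * (n C suc p)                   ≡⟨ cong (suc n *_) (middle-symmetry p) ⟩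
  suc n * (n C p)                       ≡⟨ absorption n p ⟨
  suc p * (suc n C suc p)               ∎
  where
  open ≡-Reasoning
  n = p + suc p

-- Lattice paths with r up-steps from height h that never go below 0.
ballot : ℕ → ℕ → ℕ
ballot h zero = 1
ballot zero (suc r) = ballot 1 r
ballot (suc h) (suc r) = ballot (suc (suc h)) r + ballot h (suc r)

pascal-sum : ∀ N x y {a b} → a + N C suc x ≡ N C y → b + N C x ≡ N C suc y →
             (a + b) + suc N C suc x ≡ suc N C suc y
pascal-sum N x y {a} {b} ea eb = begin
  (a + b) + suc N C suc x             ≡⟨ cong ((a + b) +_) (pascal N x) ⟨
  (a + b) + (N C x + N C suc x)       ≡⟨ regroup a b (N C x) (N C suc x) ⟩
  (a + N C suc x) + (b + N C x)       ≡⟨ cong₂ _+_ ea eb ⟩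
  N C y + N C suc y                   ≡⟨ pascal N y ⟩
  suc N C suc y                       ∎
  where
  open ≡-Reasoning
  regroup : ∀ a b c d → (a + b) + (c + d) ≡ (a + d) + (b + c)
  regroup = solve-∀

-- Reflection principle: (h + 2r) C (h + r + 1) = (h + 2r) C (r − 1) counts the paths dipping below 0.
ballot-reflection : ∀ h r → ballot h r + (h + r + r) C suc (h + r) ≡ (h + r + r) C r
ballot-reflection h zero = cong suc (k>n⇒nCk≡0 (s≤s (≤-reflexive (+-identityʳ (h + 0)))))
ballot-reflection zero (suc r) rewrite +-suc r r =
  trans (cong (_+ suc (suc (r + r)) C suc (suc r)) (sym (+-identityʳ (ballot 1 r))))
        (pascal-sum (suc (r + r)) (suc r) r (ballot-reflection 1 r) refl)
ballot-reflection (suc h) (suc r) with ballot-reflection h (suc r)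
... | ih rewrite +-suc h r | +-suc (h + r) r =
  pascal-sum (suc (suc (h + r + r))) (suc (suc (h + r))) r (ballot-reflection (suc (suc h)) r) ih

ballot-central : ∀ m → suc m * ballot 0 m ≡ (m + m) C m
ballot-central m = +-cancelʳ-≡ (m * ((m + m) C m)) (suc m * ballot 0 m) ((m + m) C m) (begin
  suc m * ballot 0 m + m * ((m + m) C m)          ≡⟨ cong (suc m * ballot 0 m +_) (central-absorption m) ⟨
  suc m * ballot 0 m + suc m * ((m + m) C suc m)  ≡⟨ *-distribˡ-+ (suc m) (ballot 0 m) _ ⟨
  suc m * (ballot 0 m + (m + m) C suc m)          ≡⟨ cong (suc m *_) (ballot-reflection 0 m) ⟩
  suc m * ((m + m) C m)                           ∎)
  where open ≡-Reasoning

ballot-zero≡catalan : ∀ m → ballot 0 m ≡ catalan m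
ballot-zero≡catalan m = begin
  ballot 0 m                    ≡⟨ m*n/n≡m (ballot 0 m) (suc m) ⟨
  ballot 0 m * suc m / suc m    ≡⟨ cong (_/ suc m) (trans (*-comm (ballot 0 m) (suc m)) (ballot-central m)) ⟩
  catalan m                     ∎
  where open ≡-Reasoning

data Step : Set where
  push pop : Step

_≟-step_ : DecidableEquality Step
push ≟-step push = yes refl
push ≟-step pop  = no λ ()
pop  ≟-step push = no λ ()
pop  ≟-step pop  = yes refl

module Derivative {A : Set} (_≟_ : DecidableEquality A) where

  derivative : A → List (List A) → List (List A)
  derivative a [] = []
  derivative a ([] ∷ ws) = derivative a ws
  derivative a ((b ∷ w) ∷ ws) with b ≟ a
  ... | yes _ = w ∷ derivative a ws
  ... | no _  = derivative a ws

  derivative-≢ : ∀ {a w} ws → All (a ∷ w ≢_) ws → All (w ≢_) (derivative a ws)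
  derivative-≢ [] [] = []
  derivative-≢ ([] ∷ ws) (_ ∷ ps) = derivative-≢ ws ps
  derivative-≢ {a} ((b ∷ v) ∷ ws) (p ∷ ps) with b ≟ a
  ... | yes refl = (λ w≡v → p (cong (a ∷_) w≡v)) ∷ derivative-≢ ws ps
  ... | no _     = derivative-≢ ws ps

  derivative-unique : ∀ a {ws} → Unique ws → Unique (derivative a ws)
  derivative-unique a {[]} [] = []
  derivative-unique a {[] ∷ ws} (_ ∷ u) = derivative-unique a u
  derivative-unique a {(b ∷ w) ∷ ws} (p ∷ u) with b ≟ a
  ... | yes refl = derivative-≢ ws p ∷ derivative-unique a u
  ... | no _     = derivative-unique a u

open Derivative _≟-step_

-- All patterns having length ≥ K + 2, every stack of height ≤ K + 1 avoids them, so while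
-- input remains a pop leaves at least K letters on the stack.
data Admissible (K : ℕ) : ℕ → ℕ → List Step → Set where
  drain : ∀ {s} → Admissible K s 0 (replicate s pop)
  push  : ∀ {s r w} → Admissible K (suc s) r w → Admissible K s (suc r) (push ∷ w)
  pop   : ∀ {s r w} → K ≤ s → Admissible K s (suc r) w → Admissible K (suc s) (suc r) (pop ∷ w)

module _ {K : ℕ} where

  admissible-drain : ∀ {s w} → Admissible K s 0 w → w ≡ replicate s pop
  admissible-drain drain = refl

  unique-drains-≤-1 : ∀ {s} ws → Unique ws → All (Admissible K s 0) ws → length ws ≤ 1
  unique-drains-≤-1 [] _ _ = z≤n
  unique-drains-≤-1 (_ ∷ []) _ _ = s≤s z≤n
  unique-drains-≤-1 (_ ∷ _ ∷ _) ((w≢v ∷ _) ∷ _) (w-drains ∷ v-drains ∷ _) =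
    contradiction (trans (admissible-drain w-drains) (sym (admissible-drain v-drains))) w≢v

  derivative-push-admissible : ∀ {s r} ws → All (Admissible K s (suc r)) ws →
                               All (Admissible K (suc s) r) (derivative push ws)
  derivative-push-admissible [] [] = []
  derivative-push-admissible ((push ∷ _) ∷ ws) (push w ∷ ps) = w ∷ derivative-push-admissible ws ps
  derivative-push-admissible ((pop ∷ _) ∷ ws) (_ ∷ ps) = derivative-push-admissible ws ps

  derivative-pop-admissible : ∀ {s r} ws → All (Admissible K (suc s) (suc r)) ws →
                              All (Admissible K s (suc r)) (derivative pop ws)
  derivative-pop-admissible [] [] = []
  derivative-pop-admissible ((push ∷ _) ∷ ws) (_ ∷ ps) = derivative-pop-admissible ws ps
  derivative-pop-admissible ((pop ∷ _) ∷ ws) (pop _ w ∷ ps) = w ∷ derivative-pop-admissible ws ps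

  length-≤-derivatives : ∀ {s r} ws → All (Admissible K s (suc r)) ws →
                         length ws ≤ length (derivative push ws) + length (derivative pop ws)
  length-≤-derivatives [] [] = z≤n
  length-≤-derivatives ((push ∷ _) ∷ ws) (_ ∷ ps) = s≤s (length-≤-derivatives ws ps)
  length-≤-derivatives ((pop ∷ _) ∷ ws) (_ ∷ ps) =
    subst (suc (length ws) ≤_) (sym (+-suc _ _)) (s≤s (length-≤-derivatives ws ps))

  length-≤-derivative-push : ∀ {s r} ws → s ≤ K → All (Admissible K s (suc r)) ws →
                             length ws ≤ length (derivative push ws)
  length-≤-derivative-push [] _ [] = z≤n
  length-≤-derivative-push ((push ∷ _) ∷ ws) s≤K (_ ∷ ps) = s≤s (length-≤-derivative-push ws s≤K ps)
  length-≤-derivative-push ((pop ∷ _) ∷ _) s≤K (pop K≤s-1 _ ∷ _) = contradiction s≤K (<⇒≱ (s≤s K≤s-1))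

  length-≤-ballot : ∀ h r {ws} → Unique ws → All (Admissible K (h + K) r) ws → length ws ≤ ballot h r
  length-≤-ballot h zero u a = unique-drains-≤-1 _ u a
  length-≤-ballot zero (suc r) {ws} u a = begin
    length ws                     ≤⟨ length-≤-derivative-push ws ≤-refl a ⟩
    length (derivative push ws)   ≤⟨ length-≤-ballot 1 r (derivative-unique push u)
                                                         (derivative-push-admissible ws a) ⟩
    ballot 1 r                    ∎
    where open ≤-Reasoning
  length-≤-ballot (suc h) (suc r) {ws} u a = begin
    length ws                                                ≤⟨ length-≤-derivatives ws a ⟩
    length (derivative push ws) + length (derivative pop ws) ≤⟨ +-mono-≤
      (length-≤-ballot (suc (suc h)) r (derivative-unique push u) (derivative-push-admissible ws a))
      (length-≤-ballot h (suc r) (derivative-unique pop u) (derivative-pop-admissible ws a)) ⟩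
    ballot (suc (suc h)) r + ballot h (suc r)                ∎
    where open ≤-Reasoning

  length-≤-ballot-below : ∀ i {s r ws} → i + s ≡ K → Unique ws → All (Admissible K s (i + r)) ws →
                          length ws ≤ ballot 0 r
  length-≤-ballot-below zero {r = r} refl u a = length-≤-ballot 0 r u a
  length-≤-ballot-below (suc i) {s} {ws = ws} i+s≡K u a = ≤-trans
    (length-≤-derivative-push ws (subst (s ≤_) i+s≡K (m≤n+m s (suc i))) a)
    (length-≤-ballot-below i (trans (+-suc i s) i+s≡K) (derivative-unique push u)
                                                      (derivative-push-admissible ws a))

OrdIso-length : ∀ xs ys → OrdIso xs ys → length xs ≡ length ys
OrdIso-length [] [] _ = refl
OrdIso-length (_ ∷ xs) (_ ∷ ys) (_ , iso) = cong suc (OrdIso-length xs ys iso)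

Contains-length : ∀ {σ τ} → Contains σ τ → length τ ≤ length σ
Contains-length {τ = τ} (sub , sub⊆σ , sub≅τ) =
  subst (_≤ _) (OrdIso-length sub τ sub≅τ) (length-mono-≤ sub⊆σ)

module _ {T : List ℕ → Set} where

  trace : ∀ {i s o} → Run T i s o → List Step
  trace done = []
  trace (push _ run) = push ∷ trace run
  trace (pop _ run) = pop ∷ trace run

  trace-injective : ∀ {i₁ s₁ i₂ s₂ o} (r₁ : Run T i₁ s₁ o) (r₂ : Run T i₂ s₂ o) →
                    trace r₁ ≡ trace r₂ → i₁ ≡ i₂ × s₁ ≡ s₂
  trace-injective done done _ = refl , refl
  trace-injective (push _ r₁) (push _ r₂) eq with trace-injective r₁ r₂ (∷-injectiveʳ eq)
  ... | refl , refl = refl , refl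
  trace-injective (pop _ r₁) (pop _ r₂) eq with trace-injective r₁ r₂ (∷-injectiveʳ eq)
  ... | refl , refl = refl , refl
  trace-injective done (push _ _) ()
  trace-injective (push _ _) done ()
  trace-injective (push _ _) (pop _ _) ()
  trace-injective (pop _ _) (push _ _) ()

  module _ {K : ℕ} (long : ∀ τ → T τ → suc (suc K) ≤ length τ) where

    short-avoids : ∀ {σ} → length σ ≤ suc K → Avoids T σ
    short-avoids σ-short τ Tτ σ⊇τ = <⇒≱ (≤-trans (s≤s σ-short) (long τ Tτ)) (Contains-length σ⊇τ)

    trace-admissible : ∀ {i s o} (run : Run T i s o) → Admissible K (length s) (length i) (trace run)
    trace-admissible done = drain
    trace-admissible (push _ run) = push (trace-admissible run)
    trace-admissible {[]} (pop _ run) rewrite admissible-drain (trace-admissible run) = drain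
    trace-admissible {_ ∷ _} (pop blocked run) =
      pop (≮⇒≥ λ st-short → blocked (short-avoids (s≤s (<⇒≤ st-short)))) (trace-admissible run)

module _ {A B : Set} {P : A → Set} (f : ∀ {x} → P x → B) where

  length-reduce : ∀ {xs} (ps : All P xs) → length (reduce f ps) ≡ length xs
  length-reduce [] = refl
  length-reduce (_ ∷ ps) = cong suc (length-reduce ps)

  reduce-All : ∀ {Q : B → Set} → (∀ {x} (p : P x) → Q (f p)) →
               ∀ {xs} (ps : All P xs) → All Q (reduce f ps)
  reduce-All q [] = []
  reduce-All q (p ∷ ps) = q p ∷ reduce-All q ps

  module _ (f-injective : ∀ {x y} (p : P x) (q : P y) → f p ≡ f q → x ≡ y) where

    reduce-≢ : ∀ {x xs} (p : P x) → All (x ≢_) xs → (ps : All P xs) → All (f p ≢_) (reduce f ps)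
    reduce-≢ p [] [] = []
    reduce-≢ p (x≢y ∷ x≢ys) (q ∷ qs) = (λ fp≡fq → x≢y (f-injective p q fp≡fq)) ∷ reduce-≢ p x≢ys qs

    reduce-unique : ∀ {xs} → Unique xs → (ps : All P xs) → Unique (reduce f ps)
    reduce-unique [] [] = []
    reduce-unique (x≢xs ∷ u) (p ∷ ps) = reduce-≢ p x≢xs ps ∷ reduce-unique u ps

m∸[2+n]+2≡m∸n : ∀ m n → 2 + n ≤ m → m ∸ (2 + n) + 2 ≡ m ∸ n
m∸[2+n]+2≡m∸n m zero 2≤m = m∸n+n≡m 2≤m
m∸[2+n]+2≡m∸n (suc m) (suc n) (s≤s 2+n≤m) = m∸[2+n]+2≡m∸n m n 2+n≤m

theorem3p1 : (k : ℕ) → 2 ≤ k → (T : List ℕ → Set) →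
    (∀ τ → T τ → IsPerm (length τ) τ × k ≤ length τ) →
    (n : ℕ) → k < n → (σ : List ℕ) → IsPerm n σ →
    (πs : List (List ℕ)) → Unique πs →
    All (λ π → IsPerm n π × STMap T π σ) πs →
    length πs ≤ catalan (n ∸ k + 2)
theorem3p1 (suc (suc K)) (s≤s (s≤s z≤n)) T T-patterns n k<n σ _ πs πs-unique preimages = begin
  length πs                          ≡⟨ length-reduce trace-of preimages ⟨
  length (reduce trace-of preimages) ≤⟨ length-≤-ballot-below K (+-identityʳ K)
                                          traces-unique traces-admissible ⟩
  ballot 0 (n ∸ K)                   ≡⟨ ballot-zero≡catalan (n ∸ K) ⟩
  catalan (n ∸ K)                    ≡⟨ cong catalan (m∸[2+n]+2≡m∸n n K k≤n) ⟨
  catalan (n ∸ suc (suc K) + 2)      ∎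
  where
  open ≤-Reasoning
  k≤n : suc (suc K) ≤ n
  k≤n = <⇒≤ k<n

  trace-of : ∀ {π} → IsPerm n π × STMap T π σ → List Step
  trace-of (_ , run) = trace run

  traces-unique : Unique (reduce trace-of preimages)
  traces-unique = reduce-unique trace-of (λ (_ , run) (_ , run′) eq → proj₁ (trace-injective run run′ eq))
                    πs-unique preimages

  length-preimage : ∀ {π} → IsPerm n π → length π ≡ K + (n ∸ K)
  length-preimage π-perm =
    trans (↭-length π-perm) (trans (length-upTo n) (sym (m+[n∸m]≡n (≤-trans (m≤n+m K 2) k≤n))))

  traces-admissible : All (Admissible K 0 (K + (n ∸ K))) (reduce trace-of preimages)
  traces-admissible = reduce-All trace-of
    (λ (π-perm , run) → subst (λ m → Admissible K 0 m (trace run)) (length-preimage π-perm)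
                          (trace-admissible (λ τ Tτ → proj₂ (T-patterns τ Tτ)) run))
    preimages
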